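{- Let $S=(N,M_0)$ be a Petri net system satisfying property $\mathcal{R}$, i.e. both $S$ and its reverse $-S$ are reversible. Then $S$ is bounded if and only if $-S$ is bounded.
   Context: A Petri net is $N=(P,T,W)$ with finite disjoint sets $P$ (places) and $T$ (transitions), $T\neq\emptyset$ (every net is assumed to have at least one transition), and $W:(P\times T)\cup(T\times P)\to\mathbb{N}$. A marking is a vector $M\in\mathbb{N}^P$; a system is $S=(N,M_0)$. A transition $t$ is enabled at $M$ if $M(p)\ge W(p,t)$ for all $p$; firing it yields $M'$ with $M'(p)=M(p)-W(p,t)+W(t,p)$. A marking is reachable if obtained by a finite sequence of successive firings from $M_0$; $R(S)$ denotes the set of reachable markings. $S$ is reversible if $M_0$ is reachable from every marking of $R(S)$. $S$ is bounded if there is $k$ with $M(p)\le k$ for all $M\in R(S)$, $p\in P$. The reverse net $-N=(P,T,W')$ is given by $W'(p,t)=W(t,p)$ and $W'(t,p)=W(p,t)$ (all arcs reversed, weights kept); the reverse system is $-S=(-N,M_0)$. $S$ satisfies property $\mathcal{R}$ if both $S$ and $-S$ are reversible. -}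

module Defs where

open import Data.Nat using (ℕ; suc; _≤_; _∸_; _+_)
open import Data.Fin using (Fin)
open import Data.Product using (∃; _×_)

-- A Petri net with places Fin np and transitions Fin (suc nt)
-- (so T is finite and nonempty), with arc weights
--   pre  p t = W(p,t),   post t p = W(t,p).
record PetriNet (np nt : ℕ) : Set where
  field
    pre  : Fin np → Fin (suc nt) → ℕ
    post : Fin (suc nt) → Fin np → ℕ

Marking : ℕ → Set
Marking np = Fin np → ℕ

record System (np nt : ℕ) : Set where
  constructor ⟨_,_⟩
  field
    net : PetriNet np nt
    M0  : Marking np

module _ {np nt : ℕ} (N : PetriNet np nt) where
  open PetriNet N

  Enabled : Fin (suc nt) → Marking np → Set
  Enabled t M = ∀ p → pre p t ≤ M p

  Fires : Marking np → Fin (suc nt) → Marking np → Set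
  Fires M t M' = Enabled t M × (∀ p → M' p ≡ M p ∸ pre p t + post t p)
    where open import Relation.Binary.PropositionalEquality using (_≡_)

  data Reach : Marking np → Marking np → Set where
    done : ∀ {M} → Reach M M
    step : ∀ {M M₁ M'} (t : Fin (suc nt)) → Fires M t M₁ → Reach M₁ M' → Reach M M'

_∈R_ : {np nt : ℕ} → Marking np → System np nt → Set
M ∈R S = Reach (System.net S) (System.M0 S) M

Reversible : {np nt : ℕ} → System np nt → Set
Reversible S = ∀ M → M ∈R S → Reach (System.net S) M (System.M0 S)

Bounded : {np nt : ℕ} → System np nt → Set
Bounded S = ∃ λ k → ∀ M → M ∈R S → ∀ p → M p ≤ k

reverseNet : {np nt : ℕ} → PetriNet np nt → PetriNet np nt
reverseNet N = record { pre = λ p t → PetriNet.post N t p ; post = λ t p → PetriNet.pre N p t }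

reverseSys : {np nt : ℕ} → System np nt → System np nt
reverseSys S = ⟨ reverseNet (System.net S) , System.M0 S ⟩

PropR : {np nt : ℕ} → System np nt → Set
PropR S = Reversible S × Reversible (reverseSys S)

-- Firing a transition t in N from A to B is the same as firing t in -N from
-- B to A, so every firing sequence of N reverses to one of -N. If -S is
-- reversible, each M ∈ R(-S) leads back to M0 in -N, and reversing that
-- sequence reaches M from M0 in N; symmetrically with S reversible. Under
-- property R the two systems thus have the same reachable markings.
module Submission where

open import Defs
open import Data.Nat using (ℕ; _≤_; _∸_; _+_)
open import Data.Nat.Properties using (m≤n+m; m+n∸n≡m; m∸n+n≡m)
open import Data.Product using (_,_)
open import Function.Bundles using (_⇔_; mk⇔)
open import Relation.Binary.PropositionalEquality using (_≡_; sym)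

module _ {np nt : ℕ} (N : PetriNet np nt) where
  open PetriNet N

  Fires-reverse : ∀ {A B t} → Fires N A t B → Fires (reverseNet N) B t A
  Fires-reverse {A} {B} {t} (enabled , B≡) = enabled-reverse , A≡
    where
    enabled-reverse : ∀ p → post t p ≤ B p
    enabled-reverse p rewrite B≡ p = m≤n+m (post t p) (A p ∸ pre p t)

    A≡ : ∀ p → A p ≡ B p ∸ post t p + pre p t
    A≡ p rewrite B≡ p | m+n∸n≡m (A p ∸ pre p t) (post t p) = sym (m∸n+n≡m (enabled p))

  Reach-reverse-prepend : ∀ {A B C} → Reach N A B → Reach (reverseNet N) A C → Reach (reverseNet N) B C
  Reach-reverse-prepend done            A⇝C = A⇝C
  Reach-reverse-prepend (step t fire r) A⇝C = Reach-reverse-prepend r (step t (Fires-reverse fire) A⇝C)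

  Reach-reverse : ∀ {A B} → Reach N A B → Reach (reverseNet N) B A
  Reach-reverse r = Reach-reverse-prepend r done

-- Applied to -S this gives the converse inclusion, since -(-S) is S up to η.
∈R-reverse : ∀ {np nt} (S : System np nt) → Reversible S → ∀ M → M ∈R S → M ∈R reverseSys S
∈R-reverse S reversible M M∈R = Reach-reverse (System.net S) (reversible M M∈R)

Bounded-mono : ∀ {np nt} {S S′ : System np nt} → (∀ M → M ∈R S′ → M ∈R S) → Bounded S → Bounded S′
Bounded-mono R[S′]⊆R[S] (k , bound) = k , λ M M∈R → bound M (R[S′]⊆R[S] M M∈R)

lemma2 : {np nt : ℕ} (S : System np nt) → PropR S → (Bounded S ⇔ Bounded (reverseSys S))
lemma2 S (reversible , reverse-reversible) = mk⇔
  (Bounded-mono (∈R-reverse (reverseSys S) reverse-reversible))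
  (Bounded-mono (∈R-reverse S reversible))
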